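{- Let ${\sf TQ}$ be the theory in the language $\{<,\cdot,{}^{ -1},\mathbf{1}\}$ axiomatized by: ($\texttt{O}_1$) $\forall x,y\,(x<y\rightarrow y\not<x)$; ($\texttt{O}_2$) $\forall x,y,z\,(x<y<z\rightarrow x<z)$; ($\texttt{O}_3$) $\forall x,y\,(x<y\vee x=y\vee y<x)$; ($\texttt{M}_1$) $\forall x,y,z\,(x\cdot(y\cdot z)=(x\cdot y)\cdot z)$; ($\texttt{M}_2$) $\forall x\,(x\cdot\mathbf{1}=x)$; ($\texttt{M}_3$) $\forall x\,(x\cdot x^{ -1}=\mathbf{1})$; ($\texttt{M}_4$) $\forall x,y\,(x\cdot y=y\cdot x)$; ($\texttt{M}_5$) $\forall x,y,z\,(x<y\rightarrow x\cdot z<y\cdot z)$; ($\texttt{M}_6$) $\exists y\,(y\neq\mathbf{1})$; ($\texttt{M}_{10}$) for each $n\geqslant 1$: $\forall x,z\,\exists y\,(x<z\rightarrow x<y^n<z)$; ($\texttt{M}_{11}$) for each $n\geqslant 1$, $q\geqslant 1$ and natural numbers $m_0,\dots,m_{q-1}>1$: $\forall x_0,\dots,x_{q-1}\,\exists y\,\forall z\,\bigwedge_{j<q,\ m_j\nmid n}(y^n\cdot x_j\neq z^{m_j})$. Then for every natural number $n>1$ the following sentences are provable in ${\sf TQ}$: $\forall u\,\exists y\,[\Re_n(y\cdot u)]$; $\forall x,u\,\exists y\,[x<y\wedge\Re_n(y\cdot u)]$; $\forall z,u\,\exists y\,[y<z\wedge\Re_n(y\cdot u)]$; $\forall x,z,u\,\exists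 y\,[x<z\rightarrow x<y<z\wedge\Re_n(y\cdot u)]$.
   Context: $y^n$ abbreviates the $n$-fold product $y\cdot\ldots\cdot y$; an empty conjunction is true. For $n>1$, $\Re_n(y)$ abbreviates the formula $\exists w\,(y=w^n)$. -}

module Defs where

open import Level using (Level; _⊔_)
open import Data.Nat as ℕ using (ℕ; zero; suc)
open import Data.Nat.Divisibility using (_∣_)
open import Data.Fin using (Fin)
open import Data.Product using (Σ; ∃; _×_; _,_)
open import Data.Sum using (_⊎_)
open import Relation.Nullary using (¬_)
open import Relation.Binary.PropositionalEquality using (_≡_; _≢_)

pow : ∀ {a} {A : Set a} → (A → A → A) → A → A → ℕ → A
pow _·_ e y zero = e
pow _·_ e y (suc zero) = y
pow _·_ e y (suc (suc n)) = y · pow _·_ e y (suc n)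

-- A model of the first-order theory TQ in the language {<, ·, ⁻¹, 1},
-- with '=' interpreted as (propositional) identity on the carrier.
record TQModel (a ℓ : Level) : Set (Level.suc (a ⊔ ℓ)) where
  infixl 7 _·_
  infix 4 _<_
  field
    Carrier : Set a
    _<_     : Carrier → Carrier → Set ℓ
    _·_     : Carrier → Carrier → Carrier
    _⁻¹     : Carrier → Carrier
    𝟏       : Carrier

  -- y ^ n : the n-fold product y · … · y (only used for n ≥ 1;
  -- by convention y ^ 0 = 𝟏)
  _^_ : Carrier → ℕ → Carrier
  _^_ = pow _·_ 𝟏

  field
    O₁ : ∀ x y → x < y → ¬ (y < x)
    O₂ : ∀ x y z → x < y → y < z → x < z
    O₃ : ∀ x y → (x < y) ⊎ (x ≡ y) ⊎ (y < x)
    M₁ : ∀ x y z → x · (y · z) ≡ (x · y) · z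
    M₂ : ∀ x → x · 𝟏 ≡ x
    M₃ : ∀ x → x · (x ⁻¹) ≡ 𝟏
    M₄ : ∀ x y → x · y ≡ y · x
    M₅ : ∀ x y z → x < y → x · z < y · z
    M₆ : ∃ λ y → y ≢ 𝟏
    M₁₀ : ∀ (n : ℕ) → 1 ℕ.≤ n → ∀ x z → ∃ λ y → x < z → (x < y ^ n) × (y ^ n < z)
    M₁₁ : ∀ (n : ℕ) → 1 ℕ.≤ n → ∀ (q : ℕ) → 1 ℕ.≤ q →
          ∀ (m : Fin q → ℕ) → (∀ j → 1 ℕ.< m j) →
          ∀ (x : Fin q → Carrier) → ∃ λ y → ∀ z → ∀ j →
          ¬ (m j ∣ n) → (y ^ n) · x j ≢ z ^ m j

  ℜ : ℕ → Carrier → Set a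
  ℜ n y = ∃ λ w → y ≡ w ^ n

module Submission where

open import Defs
open import Data.Nat using (ℕ)
open import Data.Nat.Properties using (<⇒≤)
open import Data.Product using (∃; _×_; _,_)
open import Data.Sum using (inj₁; inj₂)
open import Data.Empty using (⊥-elim)
open import Relation.Binary.PropositionalEquality using (_≡_; sym; trans; cong; subst; subst₂)

-- Translation by u is an order-automorphism of the ordered group, so an nth power
-- w ^ n lying between x · u and z · u (axiom M₁₀) yields y = w ^ n · u⁻¹ between
-- x and z with y · u = w ^ n. Unboundedness comes from an element g > 𝟏 (from M₆),
-- giving x < x · g and z · g⁻¹ < z.

module TQProperties {a ℓ} (M : TQModel a ℓ) where
  open TQModel M

  ·-identityˡ : ∀ x → 𝟏 · x ≡ x
  ·-identityˡ x = trans (M₄ 𝟏 x) (M₂ x)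

  ·-inverseˡ : ∀ x → x ⁻¹ · x ≡ 𝟏
  ·-inverseˡ x = trans (M₄ (x ⁻¹) x) (M₃ x)

  ·-·⁻¹-cancel : ∀ b u → b · u · u ⁻¹ ≡ b
  ·-·⁻¹-cancel b u = trans (sym (M₁ b u (u ⁻¹))) (trans (cong (b ·_) (M₃ u)) (M₂ b))

  ·⁻¹-·-cancel : ∀ b u → b · u ⁻¹ · u ≡ b
  ·⁻¹-·-cancel b u = trans (sym (M₁ b (u ⁻¹) u)) (trans (cong (b ·_) (·-inverseˡ u)) (M₂ b))

  <-·-translate⁻¹ : ∀ {x y} u → x · u < y → x < y · u ⁻¹
  <-·-translate⁻¹ {x} {y} u p = subst (_< y · u ⁻¹) (·-·⁻¹-cancel x u) (M₅ (x · u) y (u ⁻¹) p)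

  >-·-translate⁻¹ : ∀ {y z} u → y < z · u → y · u ⁻¹ < z
  >-·-translate⁻¹ {y} {z} u p = subst (y · u ⁻¹ <_) (·-·⁻¹-cancel z u) (M₅ y (z · u) (u ⁻¹) p)

  ∃-positive : ∃ (𝟏 <_)
  ∃-positive with M₆
  ... | y , y≢𝟏 with O₃ y 𝟏
  ... | inj₁ y<𝟏        = y ⁻¹ , subst₂ _<_ (M₃ y) (·-identityˡ (y ⁻¹)) (M₅ y 𝟏 (y ⁻¹) y<𝟏)
  ... | inj₂ (inj₁ y≡𝟏) = ⊥-elim (y≢𝟏 y≡𝟏)
  ... | inj₂ (inj₂ 𝟏<y) = y , 𝟏<y

  <-·-positive : ∀ {g} x → 𝟏 < g → x < x · g
  <-·-positive {g} x 𝟏<g = subst₂ _<_ (·-identityˡ x) (M₄ g x) (M₅ 𝟏 g x 𝟏<g)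

  ·-positive⁻¹-< : ∀ {g} z → 𝟏 < g → z · g ⁻¹ < z
  ·-positive⁻¹-< {g} z 𝟏<g = >-·-translate⁻¹ g (<-·-positive z 𝟏<g)

  ℜ-·⁻¹-· : ∀ n w u → ℜ n (w ^ n · u ⁻¹ · u)
  ℜ-·⁻¹-· n w u = w , ·⁻¹-·-cancel (w ^ n) u

  ℜ-translate-dense : ∀ n → 1 Data.Nat.≤ n → ∀ x z u →
                      ∃ λ y → x < z → (x < y) × (y < z) × ℜ n (y · u)
  ℜ-translate-dense n 1≤n x z u with M₁₀ n 1≤n (x · u) (z · u)
  ... | w , between = w ^ n · u ⁻¹ , λ x<z →
    let xu<wⁿ , wⁿ<zu = between (M₅ x z u x<z)
    in <-·-translate⁻¹ u xu<wⁿ , >-·-translate⁻¹ u wⁿ<zu , ℜ-·⁻¹-· n w u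

mainTheorem18 : ∀ {a ℓ} (M : TQModel a ℓ) → let open TQModel M in
    ∀ (n : ℕ) → 1 Data.Nat.< n →
      (∀ u → ∃ λ y → ℜ n (y · u))
      × (∀ x u → ∃ λ y → (x < y) × ℜ n (y · u))
      × (∀ z u → ∃ λ y → (y < z) × ℜ n (y · u))
      × (∀ x z u → ∃ λ y → x < z → (x < y) × (y < z) × ℜ n (y · u))
mainTheorem18 M n 1<n =
    (λ u → 𝟏 ^ n · u ⁻¹ , ℜ-·⁻¹-· n 𝟏 u)
  , (λ x u → let y , f = dense x (x · g) u
                 x<y , _ , ℜy = f (<-·-positive x 𝟏<g)
             in y , x<y , ℜy)
  , (λ z u → let y , f = dense (z · g ⁻¹) z u
                 _ , y<z , ℜy = f (·-positive⁻¹-< z 𝟏<g)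
             in y , y<z , ℜy)
  , dense
  where
    open TQModel M
    open TQProperties M
    dense = ℜ-translate-dense n (<⇒≤ 1<n)
    g = let g , _ = ∃-positive in g
    𝟏<g : 𝟏 < g
    𝟏<g = let _ , p = ∃-positive in p
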